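{- Let $D$ be a nontrivial strong digraph and $\alpha=(D_v)_{v\in V(D)}$ a family of pairwise vertex-disjoint digraphs. Then $\mathsf{d}_s^-(D[\alpha])\ge \min\{|V(D_v)|: v\in V(D)\}$.
   Context: Digraphs are finite, loopless, without parallel arcs; nontrivial means at least two vertices. A digraph is strong if for every ordered pair $u,v$ there is a directed $uv$-walk. The composition $D[\alpha]$ is obtained from $D$ by replacing each vertex $v$ by the digraph $D_v$ and adding every arc from each vertex of $D_v$ to each vertex of $D_u$ whenever $(v,u)\in A(D)$. $S\subseteq V$ is in-dominating if every vertex not in $S$ has an out-neighbor in $S$; strong in-dominating if moreover the induced subdigraph on $S$ is strong. $\mathsf{d}_s^-$ is the maximum number of classes of a partition of the vertex set into strong in-dominating sets. -}

module Defs where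

open import Data.Nat using (ℕ; zero; suc; _≤_; _⊓_)
open import Data.Fin using (Fin; zero; suc)
open import Data.Bool using (Bool; T)
open import Data.Product using (Σ; ∃; _×_; _,_)
open import Relation.Nullary using (¬_)
open import Relation.Binary.PropositionalEquality using (_≡_)

record Digraph (n : ℕ) : Set where
  field
    adj      : Fin n → Fin n → Bool
    loopless : ∀ v → ¬ T (adj v v)

open Digraph public

Arc : ∀ {n} → Digraph n → Fin n → Fin n → Set
Arc D u v = T (adj D u v)

-- Directed walk from x to z all of whose vertices after x lie in S.
data WalkIn {V : Set} (R : V → V → Set) (S : V → Set) : V → V → Set where
  here : ∀ {x} → WalkIn R S x x
  step : ∀ {x y z} → R x y → S y → WalkIn R S y z → WalkIn R S x z

StrongSet : {V : Set} → (V → V → Set) → (V → Set) → Set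
StrongSet R S = ∀ x y → S x → S y → WalkIn R S x y

Strong : {V : Set} → (V → V → Set) → Set
Strong {V} R = ∀ (x y : V) → WalkIn R (λ _ → V) x y

InDominating : {V : Set} → (V → V → Set) → (V → Set) → Set
InDominating {V} R S = ∀ (x : V) → ¬ S x → Σ V (λ y → R x y × S y)

StrongInDominating : {V : Set} → (V → V → Set) → (V → Set) → Set
StrongInDominating R S = InDominating R S × StrongSet R S

-- A partition of V into exactly k (nonempty) classes, each strong in-dominating.
-- Class i is { x | cls x ≡ i }.
record SIDPartition {V : Set} (R : V → V → Set) (k : ℕ) : Set where
  field
    cls      : V → Fin k
    nonempty : ∀ i → ∃ λ x → cls x ≡ i
    sid      : ∀ i → StrongInDominating R (λ x → cls x ≡ i)

-- d_s^-(R) ≥ k : since d_s^- is the maximum number of classes of such a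
-- partition, this holds iff some such partition has at least k classes.
dsMinus≥ : {V : Set} → (V → V → Set) → ℕ → Set
dsMinus≥ R k = ∃ λ j → k ≤ j × SIDPartition R j

-- Composition D[α]; vertex disjointness is realised by tagging with v.

CompVertex : ∀ {n} → (m : Fin n → ℕ) → Set
CompVertex {n} m = Σ (Fin n) (λ v → Fin (m v))

data CompArc {n} (D : Digraph n) (m : Fin n → ℕ) (α : (v : Fin n) → Digraph (m v))
     : CompVertex m → CompVertex m → Set where
  outer : ∀ {v u x y} → Arc D v u → CompArc D m α (v , x) (u , y)
  inner : ∀ {v x y} → Arc (α v) x y → CompArc D m α (v , x) (v , y)

minimum : ∀ {n} → (Fin (suc n) → ℕ) → ℕ
minimum {zero}  f = f zero
minimum {suc n} f = f zero ⊓ minimum (λ i → f (suc i))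

module Submission where

-- Every set S of vertices of D[α] meeting each D_w is strong in-dominating: an
-- out-neighbour of v in D (one exists, as D is strong and nontrivial) gives an arc from
-- every vertex of D_v into S, and a walk of D lifts to a walk of D[α] that passes through
-- S in each D_w it visits. With k = min |V(D_w)|, sorting the vertex x of D_w into class
-- x mod k gives k such sets partitioning V(D[α]).

open import Defs
open import Data.Nat using (ℕ; zero; suc; _≤_; NonZero; >-nonZero)
open import Data.Nat.Properties using (≤-refl; ≤-trans; m⊓n≤m; m⊓n≤n; ⊓-glb)
open import Data.Nat.DivMod using (_mod_; m<n⇒m%n≡m)
open import Data.Fin using (Fin; zero; suc; toℕ; inject≤; punchIn)
open import Data.Fin.Properties using (toℕ<n; toℕ-fromℕ<; toℕ-inject≤; toℕ-injective; punchInᵢ≢i)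
open import Data.Product using (∃; _,_; proj₁; proj₂)
open import Data.Empty using (⊥-elim)
open import Relation.Nullary using (¬_)
open import Relation.Binary.PropositionalEquality using (_≡_; refl; sym; trans; cong)

minimum-≤ : ∀ {n} (f : Fin (suc n) → ℕ) v → minimum f ≤ f v
minimum-≤ {zero}  f zero    = ≤-refl
minimum-≤ {suc n} f zero    = m⊓n≤m (f zero) _
minimum-≤ {suc n} f (suc v) = ≤-trans (m⊓n≤n (f zero) _) (minimum-≤ (λ i → f (suc i)) v)

≤-minimum : ∀ {n b} (f : Fin (suc n) → ℕ) → (∀ v → b ≤ f v) → b ≤ minimum f
≤-minimum {zero}  f b≤f = b≤f zero
≤-minimum {suc n} f b≤f = ⊓-glb (b≤f zero) (≤-minimum (λ i → f (suc i)) (λ i → b≤f (suc i)))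

toℕ-mod : ∀ {k} .{{_ : NonZero k}} (i : Fin k) → toℕ i mod k ≡ i
toℕ-mod i = toℕ-injective (trans (toℕ-fromℕ< _) (m<n⇒m%n≡m (toℕ<n i)))

walk⇒outNeighbour : ∀ {V : Set} {R : V → V → Set} {S : V → Set} {x y} →
  WalkIn R S x y → ¬ x ≡ y → ∃ λ z → R x z
walk⇒outNeighbour here                 x≢x = ⊥-elim (x≢x refl)
walk⇒outNeighbour (step {y = z} r _ _) _   = z , r

strong⇒outNeighbour : ∀ {n} (D : Digraph (suc (suc n))) → Strong (Arc D) →
  ∀ v → ∃ λ u → Arc D v u
strong⇒outNeighbour D strong v =
  walk⇒outNeighbour (strong v (punchIn v zero)) (λ v≡ → punchInᵢ≢i v zero (sym v≡))

module Composition {n} (D : Digraph n) (m : Fin n → ℕ) (α : (v : Fin n) → Digraph (m v))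
  (outNeighbour : ∀ v → ∃ λ u → Arc D v u) (strong : Strong (Arc D))
  (S : CompVertex m → Set) (meets : ∀ w → ∃ λ x → S (w , x)) where

  liftWalk : ∀ {p w u} (x : Fin (m p)) {y} → Arc D p w →
    WalkIn (Arc D) (λ _ → Fin n) w u → S (u , y) → WalkIn (CompArc D m α) S (p , x) (u , y)
  liftWalk x pw here              Sy = step (outer pw) Sy here
  liftWalk x pw (step wz _ walk) Sy =
    step (outer pw) (proj₂ (meets _)) (liftWalk (proj₁ (meets _)) wz walk Sy)

  meetsAll⇒strongInDominating : StrongInDominating (CompArc D m α) S
  meetsAll⇒strongInDominating = inDominating , strongSet
    where
    inDominating : InDominating (CompArc D m α) S
    inDominating (v , _) _ with outNeighbour v
    ... | u , vu = (u , proj₁ (meets u)) , outer vu , proj₂ (meets u)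

    strongSet : StrongSet (CompArc D m α) S
    strongSet (v , x) (u , y) _ Sy with outNeighbour v
    ... | w , vw = liftWalk x vw (strong w u) Sy

sidPartition-mod : ∀ {n} (D : Digraph (suc n)) (m : Fin (suc n) → ℕ)
  (α : (v : Fin (suc n)) → Digraph (m v)) →
  (∀ v → ∃ λ u → Arc D v u) → Strong (Arc D) →
  (k : ℕ) .{{_ : NonZero k}} → (∀ v → k ≤ m v) → SIDPartition (CompArc D m α) k
sidPartition-mod D m α outNeighbour strong k k≤m = record
  { cls      = cls
  ; nonempty = λ i → (zero , rep i zero) , clsRep i zero
  ; sid      = λ i → Composition.meetsAll⇒strongInDominating D m α outNeighbour strong
                       (λ x → cls x ≡ i) (λ w → rep i w , clsRep i w)
  }
  where
  cls : CompVertex m → Fin k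
  cls (_ , x) = toℕ x mod k

  rep : Fin k → ∀ w → Fin (m w)
  rep i w = inject≤ i (k≤m w)

  clsRep : ∀ i w → cls (w , rep i w) ≡ i
  clsRep i w = trans (cong (_mod k) (toℕ-inject≤ i (k≤m w))) (toℕ-mod i)

theorem8 : (n : ℕ) (D : Digraph (suc (suc n))) → Strong (Arc D) →
    (m : Fin (suc (suc n)) → ℕ) → (∀ v → 1 ≤ m v) →
    (α : (v : Fin (suc (suc n))) → Digraph (m v)) →
    dsMinus≥ (CompArc D m α) (minimum m)
theorem8 n D strong m 1≤m α =
  minimum m , ≤-refl ,
  sidPartition-mod D m α (strong⇒outNeighbour D strong) strong (minimum m)
    {{>-nonZero (≤-minimum m 1≤m)}} (minimum-≤ m)
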